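{- There exist constants $c_1,c_2,c_3,c_4>0$ such that for every sufficiently large $n$, there are a positive integer $K\le c_1n$, a number $\varepsilon\in(0,c_2/n^2]$, a number $\tau\in(0,c_3n]$, $c=1$, and a family $\mathcal F$ of subsets of $[K]$ with $|\mathcal F|\ge 2^{c_4n}$ such that: (i) for each $S\in\mathcal F$ there is an $(\varepsilon,\tau,c)$-enumeration-hard game $(R_S,C_S)$ with respect to $S$, with $R_S,C_S\in[-1,1]^{K\times K}$; (ii) for any distinct $S,S'\in\mathcal F$, $\|u_{cK,S}-u_{cK,S'}\|_1>\frac{18}{c}(\tau+1)\varepsilon$.
   Context: For a game $(R,C)$ on $K$ strategies, mixed strategies lie in $\Delta_K=\{x\in[0,1]^K:\sum x_i=1\}$, $e_i$ is the $i$-th pure strategy; $(x,y)$ is an $\varepsilon$-WNE if $x_i>0\Rightarrow e_i^\top Ry\ge\max_ke_k^\top Ry-\varepsilon$ and $y_j>0\Rightarrow x^\top Ce_j\ge\max_kx^\top Ce_k-\varepsilon$. $\mathrm{supp}(v)$ is the set of nonzero coordinates. For $S\subseteq[K]$ and $m\le K$, $u_{m,S}\in\mathbb{R}^m$ has $i$-th coordinate $1/|S|$ if $i\in S$ and $0$ otherwise. For $\tau>0$, $\varepsilon,c\in[0,1]$ with $cK$ an integer and $S\subseteq[K]$, a game $(R_S,C_S)$ with $R_S,C_S\in[-1,1]^{K\times K}$ is $(\varepsilon,\tau,c)$-enumeration-hard w.r.t. $S$ if (1) for every $y\in\Delta_K$ some $i$ has $e_i^\top R_Sy\ge1/2$,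 and for every $x\in\Delta_K$ some $j$ has $x^\top C_Se_j\ge1/2$; (2) for every $\varepsilon$-WNE $(x,y)$, with $\tilde x=(x_1,\dots,x_{cK})$, $\tilde y=(y_1,\dots,y_{cK})$: (a) $\mathrm{supp}(\tilde x),\mathrm{supp}(\tilde y)\subseteq S$; (b) $\|\tilde x-c\,u_{cK,S}\|_1\le\tau\varepsilon$ and $\|\tilde y-c\,u_{cK,S}\|_1\le\tau\varepsilon$.
   Formalization: The numbers ε and τ and the entries of $R_S,C_S$ are taken in the rationals, and in conditions (1) and (2) the mixed strategies range only over rational points of $\Delta_K$. -}

module Defs where

open import Data.Nat as ℕ using (ℕ; zero; suc)
open import Data.Integer using (+_)
open import Data.Fin using (Fin; zero; suc; inject≤)
open import Data.Fin.Subset using (Subset; _∈_) renaming (∣_∣ to card)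
open import Data.Fin.Subset.Properties using (_∈?_)
open import Data.Rational using (ℚ; 0ℚ; 1ℚ; ½; _+_; _*_; _-_; -_; _≤_; _<_; _/_; ∣_∣)
open import Data.Product using (Σ; ∃; _×_)
open import Relation.Binary.PropositionalEquality using (_≡_; _≢_)
open import Relation.Nullary using (yes; no)

ℕ→ℚ : ℕ → ℚ
ℕ→ℚ m = + m / 1

sumF : ∀ {n} → (Fin n → ℚ) → ℚ
sumF {zero}  f = 0ℚ
sumF {suc n} f = f zero + sumF (λ i → f (suc i))

norm1 : ∀ {n} → (Fin n → ℚ) → ℚ
norm1 f = sumF (λ i → ∣ f i ∣)

Mixed : (K : ℕ) → (Fin K → ℚ) → Set
Mixed K x = (∀ i → 0ℚ ≤ x i) × sumF x ≡ 1ℚ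

Matrix : ℕ → Set
Matrix K = Fin K → Fin K → ℚ

Bounded : ∀ {K} → Matrix K → Set
Bounded M = ∀ i j → (- 1ℚ ≤ M i j) × (M i j ≤ 1ℚ)

rowPay : ∀ {K} → Matrix K → (Fin K → ℚ) → Fin K → ℚ
rowPay R y i = sumF (λ j → R i j * y j)

colPay : ∀ {K} → Matrix K → (Fin K → ℚ) → Fin K → ℚ
colPay C x j = sumF (λ i → x i * C i j)

-- ε-well-supported Nash equilibrium ("≥ max_k … - ε" unfolded as "for all k")
WNE : ∀ {K} → ℚ → Matrix K → Matrix K → (Fin K → ℚ) → (Fin K → ℚ) → Set
WNE ε R C x y =
  (∀ i → x i ≢ 0ℚ → ∀ k → rowPay R y k - ε ≤ rowPay R y i) ×
  (∀ j → y j ≢ 0ℚ → ∀ k → colPay C x k - ε ≤ colPay C x j)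

-- 1/s, with the (irrelevant) convention 1/0 := 0
inv : ℕ → ℚ
inv zero    = 0ℚ
inv (suc k) = + 1 / suc k

uvec : ∀ {K} m → m ℕ.≤ K → Subset K → Fin m → ℚ
uvec m m≤K S i with inject≤ i m≤K ∈? S
... | yes _ = inv (card S)
... | no  _ = 0ℚ

prefix : ∀ {K} m → m ℕ.≤ K → (Fin K → ℚ) → Fin m → ℚ
prefix m m≤K x i = x (inject≤ i m≤K)

-- (ε,τ,c)-enumeration-hard game w.r.t. S; m plays the role of cK (c*K = m)
EnumHard : (K : ℕ) → ℚ → ℚ → ℚ → (m : ℕ) → m ℕ.≤ K → Subset K →
           Matrix K → Matrix K → Set
EnumHard K ε τ c m m≤K S R C =
  (c * ℕ→ℚ K ≡ ℕ→ℚ m) ×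
  Bounded R × Bounded C ×
  ((y : Fin K → ℚ) → Mixed K y → ∃ λ i → ½ ≤ rowPay R y i) ×
  ((x : Fin K → ℚ) → Mixed K x → ∃ λ j → ½ ≤ colPay C x j) ×
  ((x y : Fin K → ℚ) → Mixed K x → Mixed K y → WNE ε R C x y →
     (∀ (i : Fin m) → prefix m m≤K x i ≢ 0ℚ → inject≤ i m≤K ∈ S) ×
     (∀ (i : Fin m) → prefix m m≤K y i ≢ 0ℚ → inject≤ i m≤K ∈ S) ×
     (norm1 (λ i → prefix m m≤K x i - c * uvec m m≤K S i) ≤ τ * ε) ×
     (norm1 (λ i → prefix m m≤K y i - c * uvec m m≤K S i) ≤ τ * ε))

{-# OPTIONS --safe #-}
-- Take K = n + 1 and the 2ⁿ subsets S of [K] containing 0.  In the game (R_S, C_S)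
-- a row i ∈ S pays ½ + ½ yᵢ, a column j ∈ S pays 1 − ½ xⱼ, and every strategy
-- outside S pays −1: inside S the row player chases the column player, who runs
-- away.  Let 2Kε < 1 and (x, y) be an ε-WNE.  Both supports lie in S, since a
-- strategy in S beats every strategy outside S by at least 3/2.  If xᵢ > xₖ + 2ε
-- for i, k ∈ S, then column i is not an ε-best response, so yᵢ = 0, while row i
-- is one, so y ≤ 2ε on S and y cannot have mass 1.  If yᵢ > yₖ + 2ε, then row k
-- is not an ε-best response, so xₖ = 0, and by the first part x ≤ 2ε on S, again
-- impossible.  So x and y are 2ε-nearly uniform on S, hence coordinatewise
-- 2ε-close to u_S, which gives τ = 2K.  Distinct S, S′ disagree at some
-- coordinate, where u_S and u_S′ differ by 1/|S| or 1/|S′| ≥ 1/K, and ε is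
-- chosen with 18 (τ + 1) ε < 1/K.
module Submission where

open import Defs
open import Data.Nat as ℕ using (ℕ; zero; suc; _^_; z≤n; s≤s)
import Data.Nat.Properties as ℕ
open import Data.Nat.Properties using (≤-refl)
open import Data.Nat.Tactic.RingSolver using (solve-∀)
import Data.Nat.Coprimality as Coprime
import Data.Integer as ℤ
import Data.Integer.Properties as ℤ
open import Data.Rational
  using (ℚ; mkℚ; 0ℚ; 1ℚ; ½; _+_; _*_; _-_; -_; _≤_; _<_; _/_; ∣_∣; Positive; nonNegative; *≤*; *<*)
open import Data.Rational.Properties hiding (≤-refl)
open import Data.Rational.Solver using (module +-*-Solver)
open import Data.Fin using (Fin; zero; suc; inject≤)
open import Data.Fin.Properties using (inject≤-refl; toℕ<n)
open import Data.Fin.Subset using (Subset; inside; outside; _∈_; _∉_; Nonempty) renaming (∣_∣ to card)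
open import Data.Fin.Subset.Properties using (_∈?_; ∣p∣≤n; x∈p⇒∣p-x∣<∣p∣; drop-there)
open import Data.Vec using ([]; _∷_; here; there)
open import Data.Vec.Properties using (∷-injectiveʳ)
open import Data.Bool using (true; false; if_then_else_)
open import Data.Product using (∃; _×_; _,_; proj₁; proj₂)
open import Data.Sum using (_⊎_; inj₁; inj₂)
open import Data.Empty using (⊥-elim)
open import Function using (_∘_)
open import Relation.Nullary using (¬_; yes; no; does; contradiction)
open import Relation.Nullary.Decidable using (dec-true; dec-false; decidable-stable)
open import Relation.Binary.PropositionalEquality
open import Data.List using (List; []; _∷_; map; _++_; length)
open import Data.List.Properties using (length-map; length-++)
open import Data.List.Relation.Unary.All using ([])
open import Data.List.Relation.Unary.AllPairs using ([]; _∷_)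
open import Data.List.Relation.Unary.Unique.Propositional using (Unique)
open import Data.List.Relation.Unary.Unique.Propositional.Properties using (map⁺; ++⁺)
open import Data.List.Membership.Propositional using () renaming (_∈_ to _∈L_)
open import Data.List.Membership.Propositional.Properties using (∈-map⁻)

open +-*-Solver

ℕ→ℚ≡mkℚ : ∀ m → ℕ→ℚ m ≡ mkℚ (ℤ.+ m) 0 (Coprime.sym (Coprime.1-coprimeTo m))
ℕ→ℚ≡mkℚ m = normalize-coprime _

ℕ→ℚ-homo-+ : ∀ m n → ℕ→ℚ (m ℕ.+ n) ≡ ℕ→ℚ m + ℕ→ℚ n
ℕ→ℚ-homo-+ m n rewrite ℕ→ℚ≡mkℚ m | ℕ→ℚ≡mkℚ n =
  cong (_/ 1) (cong₂ ℤ._+_ (sym (ℤ.*-identityʳ (ℤ.+ m))) (sym (ℤ.*-identityʳ (ℤ.+ n))))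

ℕ→ℚ-homo-* : ∀ m n → ℕ→ℚ (m ℕ.* n) ≡ ℕ→ℚ m * ℕ→ℚ n
ℕ→ℚ-homo-* m n rewrite ℕ→ℚ≡mkℚ m | ℕ→ℚ≡mkℚ n = cong (_/ 1) (ℤ.pos-* m n)

ℕ→ℚ-suc-* : ∀ m a → ℕ→ℚ (suc m) * a ≡ a + ℕ→ℚ m * a
ℕ→ℚ-suc-* m a = begin
  ℕ→ℚ (suc m) * a       ≡⟨ cong (_* a) (ℕ→ℚ-homo-+ 1 m) ⟩
  (1ℚ + ℕ→ℚ m) * a      ≡⟨ *-distribʳ-+ a 1ℚ (ℕ→ℚ m) ⟩
  1ℚ * a + ℕ→ℚ m * a    ≡⟨ cong (_+ ℕ→ℚ m * a) (*-identityˡ a) ⟩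
  a + ℕ→ℚ m * a         ∎
  where open ≡-Reasoning

ℕ→ℚ-mono-≤ : ∀ {m n} → m ℕ.≤ n → ℕ→ℚ m ≤ ℕ→ℚ n
ℕ→ℚ-mono-≤ {m} {n} m≤n rewrite ℕ→ℚ≡mkℚ m | ℕ→ℚ≡mkℚ n =
  *≤* (ℤ.*-monoʳ-≤-nonNeg (ℤ.+ 1) (ℤ.+≤+ m≤n))

ℕ→ℚ-mono-< : ∀ {m n} → m ℕ.< n → ℕ→ℚ m < ℕ→ℚ n
ℕ→ℚ-mono-< {m} {n} m<n rewrite ℕ→ℚ≡mkℚ m | ℕ→ℚ≡mkℚ n =
  *<* (ℤ.*-monoʳ-<-pos (ℤ.+ 1) (ℤ.+<+ m<n))

ℕ→ℚ-pos : ∀ m .{{_ : ℕ.NonZero m}} → Positive (ℕ→ℚ m)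
ℕ→ℚ-pos m = normalize-pos m 1

inv-pos : ∀ m .{{_ : ℕ.NonZero m}} → Positive (inv m)
inv-pos (suc m) = normalize-pos 1 (suc m)

inv-nonNeg : ∀ m → 0ℚ ≤ inv m
inv-nonNeg zero    = ≤-reflexive refl
inv-nonNeg (suc m) = <⇒≤ (positive⁻¹ (inv (suc m)) {{inv-pos (suc m)}})

ℕ→ℚ*inv≡1 : ∀ m .{{_ : ℕ.NonZero m}} → ℕ→ℚ m * inv m ≡ 1ℚ
ℕ→ℚ*inv≡1 (suc m) =
  trans (cong₂ _*_ (ℕ→ℚ≡mkℚ (suc m)) (normalize-coprime {1} {m} (Coprime.1-coprimeTo (suc m))))
        (*-inverseʳ (mkℚ (ℤ.+ suc m) 0 (Coprime.sym (Coprime.1-coprimeTo (suc m)))))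

*inv<inv : ∀ a k m .{{_ : ℕ.NonZero k}} .{{_ : ℕ.NonZero m}} →
           a ℕ.* k ℕ.< m → ℕ→ℚ a * inv m < inv k
*inv<inv a k m ak<m = *-cancelʳ-<-nonNeg (ℕ→ℚ k) {{pos⇒nonNeg (ℕ→ℚ k) {{ℕ→ℚ-pos k}}}} (begin-strict
  ℕ→ℚ a * inv m * ℕ→ℚ k   ≡⟨ solve 3 (λ a i k → a :* i :* k := a :* k :* i) refl (ℕ→ℚ a) (inv m) (ℕ→ℚ k) ⟩
  ℕ→ℚ a * ℕ→ℚ k * inv m   ≡⟨ cong (_* inv m) (ℕ→ℚ-homo-* a k) ⟨
  ℕ→ℚ (a ℕ.* k) * inv m   <⟨ *-monoˡ-<-pos (inv m) {{inv-pos m}} (ℕ→ℚ-mono-< ak<m) ⟩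
  ℕ→ℚ m * inv m           ≡⟨ ℕ→ℚ*inv≡1 m ⟩
  1ℚ                      ≡⟨ ℕ→ℚ*inv≡1 k ⟨
  ℕ→ℚ k * inv k           ≡⟨ *-comm (ℕ→ℚ k) (inv k) ⟩
  inv k * ℕ→ℚ k           ∎)
  where open ≤-Reasoning

p≤q+r⇒p-r≤q : ∀ {p q r} → p ≤ q + r → p - r ≤ q
p≤q+r⇒p-r≤q {p} {q} {r} p≤q+r = begin
  p - r      ≤⟨ +-monoˡ-≤ (- r) p≤q+r ⟩
  q + r - r  ≡⟨ solve 2 (λ q r → q :+ r :- r := q) refl q r ⟩
  q          ∎
  where open ≤-Reasoning

p-r≤q⇒p≤q+r : ∀ {p q r} → p - r ≤ q → p ≤ q + r
p-r≤q⇒p≤q+r {p} {q} {r} p-r≤q = begin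
  p          ≡⟨ solve 2 (λ p r → p := p :- r :+ r) refl p r ⟩
  p - r + r  ≤⟨ +-monoˡ-≤ r p-r≤q ⟩
  q + r      ∎
  where open ≤-Reasoning

∣p-q∣≤r : ∀ {p q r} → p ≤ q + r → q ≤ p + r → ∣ p - q ∣ ≤ r
∣p-q∣≤r {p} {q} {r} p≤q+r q≤p+r with ∣p∣≡p∨∣p∣≡-p (p - q)
... | inj₁ ∣p-q∣≡p-q = begin
  ∣ p - q ∣  ≡⟨ ∣p-q∣≡p-q ⟩
  p - q      ≤⟨ p≤q+r⇒p-r≤q (subst (p ≤_) (+-comm q r) p≤q+r) ⟩
  r          ∎
  where open ≤-Reasoning
... | inj₂ ∣p-q∣≡q-p = begin
  ∣ p - q ∣  ≡⟨ ∣p-q∣≡q-p ⟩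
  - (p - q)  ≡⟨ solve 2 (λ p q → :- (p :- q) := q :- p) refl p q ⟩
  q - p      ≤⟨ p≤q+r⇒p-r≤q (subst (q ≤_) (+-comm p r) q≤p+r) ⟩
  r          ∎
  where open ≤-Reasoning

∣p-q∣≡∣q-p∣ : ∀ p q → ∣ p - q ∣ ≡ ∣ q - p ∣
∣p-q∣≡∣q-p∣ p q = trans (cong ∣_∣ (solve 2 (λ p q → p :- q := :- (q :- p)) refl p q)) (∣-p∣≡∣p∣ (q - p))

sumF-cong : ∀ {K} {f g : Fin K → ℚ} → (∀ i → f i ≡ g i) → sumF f ≡ sumF g
sumF-cong {zero}  f≗g = refl
sumF-cong {suc K} f≗g = cong₂ _+_ (f≗g zero) (sumF-cong (f≗g ∘ suc))

sumF-+ : ∀ {K} (f g : Fin K → ℚ) → sumF (λ i → f i + g i) ≡ sumF f + sumF g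
sumF-+ {zero}  f g = refl
sumF-+ {suc K} f g = begin
  f zero + g zero + sumF (λ i → f (suc i) + g (suc i))
    ≡⟨ cong ((f zero + g zero) +_) (sumF-+ (f ∘ suc) (g ∘ suc)) ⟩
  f zero + g zero + (sumF (f ∘ suc) + sumF (g ∘ suc))
    ≡⟨ solve 4 (λ a b c d → a :+ b :+ (c :+ d) := a :+ c :+ (b :+ d)) refl
               (f zero) (g zero) (sumF (f ∘ suc)) (sumF (g ∘ suc)) ⟩
  f zero + sumF (f ∘ suc) + (g zero + sumF (g ∘ suc))
    ∎
  where open ≡-Reasoning

sumF-*ˡ : ∀ {K} c (f : Fin K → ℚ) → sumF (λ i → c * f i) ≡ c * sumF f
sumF-*ˡ {zero}  c f = sym (*-zeroʳ c)
sumF-*ˡ {suc K} c f = trans (cong (c * f zero +_) (sumF-*ˡ c (f ∘ suc))) (sym (*-distribˡ-+ c _ _))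

sumF-const : ∀ {K} a → sumF {K} (λ _ → a) ≡ ℕ→ℚ K * a
sumF-const {zero}  a = sym (*-zeroˡ a)
sumF-const {suc K} a = trans (cong (a +_) (sumF-const {K} a)) (sym (ℕ→ℚ-suc-* K a))

sumF-mono-≤ : ∀ {K} {f g : Fin K → ℚ} → (∀ i → f i ≤ g i) → sumF f ≤ sumF g
sumF-mono-≤ {zero}  f≤g = ≤-reflexive refl
sumF-mono-≤ {suc K} f≤g = +-mono-≤ (f≤g zero) (sumF-mono-≤ (f≤g ∘ suc))

sumF-nonNeg : ∀ {K} {f : Fin K → ℚ} → (∀ i → 0ℚ ≤ f i) → 0ℚ ≤ sumF f
sumF-nonNeg {zero}  f≥0 = ≤-reflexive refl
sumF-nonNeg {suc K} f≥0 = +-mono-≤ (f≥0 zero) (sumF-nonNeg (f≥0 ∘ suc))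

≤-sumF : ∀ {K} {f : Fin K → ℚ} → (∀ i → 0ℚ ≤ f i) → ∀ k → f k ≤ sumF f
≤-sumF {suc K} {f} f≥0 zero = begin
  f zero       ≡⟨ +-identityʳ (f zero) ⟨
  f zero + 0ℚ  ≤⟨ +-monoʳ-≤ (f zero) (sumF-nonNeg (f≥0 ∘ suc)) ⟩
  sumF f       ∎
  where open ≤-Reasoning
≤-sumF {suc K} {f} f≥0 (suc k) = begin
  f (suc k)       ≡⟨ +-identityˡ (f (suc k)) ⟨
  0ℚ + f (suc k)  ≤⟨ +-mono-≤ (f≥0 zero) (≤-sumF (f≥0 ∘ suc) k) ⟩
  sumF f          ∎
  where open ≤-Reasoning

indicator : ∀ {K} → Subset K → ℚ → Fin K → ℚ
indicator S a i = if does (i ∈? S) then a else 0ℚ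

sumF-indicator : ∀ {K} (S : Subset K) a → sumF (indicator S a) ≡ ℕ→ℚ (card S) * a
sumF-indicator []            a = sym (*-zeroˡ a)
sumF-indicator (inside ∷ S)  a = trans (cong (a +_) (sumF-indicator S a)) (sym (ℕ→ℚ-suc-* (card S) a))
sumF-indicator (outside ∷ S) a = trans (+-identityˡ _) (sumF-indicator S a)

δ : ∀ {K} → Fin K → Fin K → ℚ
δ zero    zero    = 1ℚ
δ zero    (suc _) = 0ℚ
δ (suc _) zero    = 0ℚ
δ (suc i) (suc j) = δ i j

δ≡0⊎δ≡1 : ∀ {K} (i j : Fin K) → δ i j ≡ 0ℚ ⊎ δ i j ≡ 1ℚ
δ≡0⊎δ≡1 zero    zero    = inj₂ refl
δ≡0⊎δ≡1 zero    (suc _) = inj₁ refl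
δ≡0⊎δ≡1 (suc _) zero    = inj₁ refl
δ≡0⊎δ≡1 (suc i) (suc j) = δ≡0⊎δ≡1 i j

sumF-δ : ∀ {K} (i : Fin K) (y : Fin K → ℚ) → sumF (λ j → δ i j * y j) ≡ y i
sumF-δ {suc K} zero y = begin
  1ℚ * y zero + sumF (λ j → 0ℚ * y (suc j))  ≡⟨ cong₂ _+_ (*-identityˡ (y zero)) (sumF-*ˡ 0ℚ (y ∘ suc)) ⟩
  y zero + 0ℚ * sumF (y ∘ suc)               ≡⟨ cong (y zero +_) (*-zeroˡ (sumF (y ∘ suc))) ⟩
  y zero + 0ℚ                                ≡⟨ +-identityʳ (y zero) ⟩
  y zero                                     ∎
  where open ≡-Reasoning
sumF-δ {suc K} (suc i) y = trans (cong₂ _+_ (*-zeroˡ (y zero)) (sumF-δ i (y ∘ suc))) (+-identityˡ (y (suc i)))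

sumF-linear-δ : ∀ {K} a b (i : Fin K) (y : Fin K → ℚ) →
                sumF (λ j → a * y j + b * (δ i j * y j)) ≡ a * sumF y + b * y i
sumF-linear-δ a b i y = begin
  sumF (λ j → a * y j + b * (δ i j * y j))               ≡⟨ sumF-+ (λ j → a * y j) (λ j → b * (δ i j * y j)) ⟩
  sumF (λ j → a * y j) + sumF (λ j → b * (δ i j * y j))  ≡⟨ cong₂ _+_ (sumF-*ˡ a y) (sumF-*ˡ b (λ j → δ i j * y j)) ⟩
  a * sumF y + b * sumF (λ j → δ i j * y j)              ≡⟨ cong (λ t → a * sumF y + b * t) (sumF-δ i y) ⟩
  a * sumF y + b * y i                                   ∎
  where open ≡-Reasoning

-- Distributions close to uniform on a subset

card-nonZero : ∀ {K} {S : Subset K} {i} → i ∈ S → ℕ.NonZero (card S)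
card-nonZero i∈S = ℕ.>-nonZero (ℕ.m<n⇒0<n (x∈p⇒∣p-x∣<∣p∣ i∈S))

SupportedIn : ∀ {K} → Subset K → (Fin K → ℚ) → Set
SupportedIn S z = ∀ i → z i ≢ 0ℚ → i ∈ S

NearlyUniformOn : ∀ {K} → Subset K → ℚ → (Fin K → ℚ) → Set
NearlyUniformOn S η z = ∀ {i k} → i ∈ S → k ∈ S → z i ≤ z k + η

module _ {K} {S : Subset K} {z : Fin K → ℚ} where

  supportedIn-∉ : SupportedIn S z → ∀ {i} → i ∉ S → z i ≡ 0ℚ
  supportedIn-∉ supp {i} i∉S = decidable-stable (z i ≟ 0ℚ) (i∉S ∘ supp i)

  sumF-≤-card* : ∀ {a} → SupportedIn S z → (∀ {k} → k ∈ S → z k ≤ a) → sumF z ≤ ℕ→ℚ (card S) * a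
  sumF-≤-card* {a} supp z≤a = begin
    sumF z                ≤⟨ sumF-mono-≤ z≤indicator ⟩
    sumF (indicator S a)  ≡⟨ sumF-indicator S a ⟩
    ℕ→ℚ (card S) * a      ∎
    where
    open ≤-Reasoning
    z≤indicator : ∀ i → z i ≤ indicator S a i
    z≤indicator i with i ∈? S
    ... | yes i∈S = z≤a i∈S
    ... | no  i∉S = ≤-reflexive (supportedIn-∉ supp i∉S)

  card*-≤-sumF : ∀ {a} → (∀ i → 0ℚ ≤ z i) → (∀ {k} → k ∈ S → a ≤ z k) → ℕ→ℚ (card S) * a ≤ sumF z
  card*-≤-sumF {a} z≥0 a≤z = begin
    ℕ→ℚ (card S) * a      ≡⟨ sumF-indicator S a ⟨
    sumF (indicator S a)  ≤⟨ sumF-mono-≤ indicator≤z ⟩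
    sumF z                ∎
    where
    open ≤-Reasoning
    indicator≤z : ∀ i → indicator S a i ≤ z i
    indicator≤z i with i ∈? S
    ... | yes i∈S = a≤z i∈S
    ... | no  _   = z≥0 i

  vanishing-near-all⇒1≤K*η : ∀ {η i} → Mixed K z → SupportedIn S z → 0ℚ ≤ η → z i ≡ 0ℚ →
                             (∀ {k} → k ∈ S → z k ≤ z i + η) → 1ℚ ≤ ℕ→ℚ K * η
  vanishing-near-all⇒1≤K*η {η} {i} (z≥0 , Σz≡1) supp 0≤η zᵢ≡0 near = begin
    1ℚ                        ≡⟨ Σz≡1 ⟨
    sumF z                    ≤⟨ sumF-mono-≤ bound ⟩
    sumF {K} (λ _ → z i + η)  ≡⟨ sumF-const {K} (z i + η) ⟩
    ℕ→ℚ K * (z i + η)         ≡⟨ cong (λ t → ℕ→ℚ K * (t + η)) zᵢ≡0 ⟩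
    ℕ→ℚ K * (0ℚ + η)          ≡⟨ cong (ℕ→ℚ K *_) (+-identityˡ η) ⟩
    ℕ→ℚ K * η                 ∎
    where
    open ≤-Reasoning
    bound : ∀ k → z k ≤ z i + η
    bound k with k ∈? S
    ... | yes k∈S = near k∈S
    ... | no  k∉S = subst (_≤ z i + η) (sym (supportedIn-∉ supp k∉S)) (+-mono-≤ (z≥0 i) 0≤η)

  nearlyUniform⇒close : ∀ {η i} → Mixed K z → SupportedIn S z → NearlyUniformOn S η z → i ∈ S →
                        ∣ z i - inv (card S) ∣ ≤ η
  nearlyUniform⇒close {η} {i} (z≥0 , Σz≡1) supp uniform i∈S = ∣p-q∣≤r zᵢ≤inv+η inv≤zᵢ+η
    where
    open ≤-Reasoning
    instance
      s≢0 : ℕ.NonZero (card S)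
      s≢0 = card-nonZero i∈S
    s : ℚ
    s = ℕ→ℚ (card S)
    inv≤zᵢ+η : inv (card S) ≤ z i + η
    inv≤zᵢ+η = *-cancelˡ-≤-pos s {{ℕ→ℚ-pos (card S)}} (begin
      s * inv (card S)  ≡⟨ ℕ→ℚ*inv≡1 (card S) ⟩
      1ℚ                ≡⟨ Σz≡1 ⟨
      sumF z            ≤⟨ sumF-≤-card* supp (λ k∈S → uniform k∈S i∈S) ⟩
      s * (z i + η)     ∎)
    zᵢ≤inv+η : z i ≤ inv (card S) + η
    zᵢ≤inv+η = p-r≤q⇒p≤q+r (*-cancelˡ-≤-pos s {{ℕ→ℚ-pos (card S)}} (begin
      s * (z i - η)     ≤⟨ card*-≤-sumF z≥0 (λ k∈S → p≤q+r⇒p-r≤q (uniform i∈S k∈S)) ⟩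
      sumF z            ≡⟨ Σz≡1 ⟩
      1ℚ                ≡⟨ ℕ→ℚ*inv≡1 (card S) ⟨
      s * inv (card S)  ∎))

  nearlyUniform⇒norm1 : ∀ {η} → 0ℚ ≤ η → Mixed K z → SupportedIn S z → NearlyUniformOn S η z →
                        norm1 (λ i → prefix K ≤-refl z i - 1ℚ * uvec K ≤-refl S i) ≤ ℕ→ℚ K * η
  nearlyUniform⇒norm1 {η} 0≤η z∈Δ supp uniform = begin
    norm1 (λ i → prefix K ≤-refl z i - 1ℚ * uvec K ≤-refl S i)  ≤⟨ sumF-mono-≤ close ⟩
    sumF {K} (λ _ → η)                                          ≡⟨ sumF-const {K} η ⟩
    ℕ→ℚ K * η                                                   ∎
    where
    open ≤-Reasoning
    close : ∀ i → ∣ prefix K ≤-refl z i - 1ℚ * uvec K ≤-refl S i ∣ ≤ η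
    close i with inject≤ i ≤-refl ∈? S
    ... | yes j∈S rewrite *-identityˡ (inv (card S)) = nearlyUniform⇒close z∈Δ supp uniform j∈S
    ... | no  j∉S rewrite supportedIn-∉ supp j∉S = 0≤η

-- The game (R_S, C_S)

rowGame : ∀ {K} → Subset K → Matrix K
rowGame S i j = if does (i ∈? S) then ½ + ½ * δ i j else - 1ℚ

colGame : ∀ {K} → Subset K → Matrix K
colGame S i j = if does (j ∈? S) then 1ℚ - ½ * δ j i else - 1ℚ

rowGame-bounded : ∀ {K} (S : Subset K) → Bounded (rowGame S)
rowGame-bounded S i j with does (i ∈? S) | δ≡0⊎δ≡1 i j
... | true  | inj₁ δ≡0 rewrite δ≡0 = ≤ᵇ⇒≤ _ , ≤ᵇ⇒≤ _
... | true  | inj₂ δ≡1 rewrite δ≡1 = ≤ᵇ⇒≤ _ , ≤ᵇ⇒≤ _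
... | false | _                    = ≤ᵇ⇒≤ _ , ≤ᵇ⇒≤ _

colGame-bounded : ∀ {K} (S : Subset K) → Bounded (colGame S)
colGame-bounded S i j with does (j ∈? S) | δ≡0⊎δ≡1 j i
... | true  | inj₁ δ≡0 rewrite δ≡0 = ≤ᵇ⇒≤ _ , ≤ᵇ⇒≤ _
... | true  | inj₂ δ≡1 rewrite δ≡1 = ≤ᵇ⇒≤ _ , ≤ᵇ⇒≤ _
... | false | _                    = ≤ᵇ⇒≤ _ , ≤ᵇ⇒≤ _

module _ {K} {S : Subset K} where

  rowPay-∈ : ∀ {y i} → sumF y ≡ 1ℚ → i ∈ S → rowPay (rowGame S) y i ≡ ½ + ½ * y i
  rowPay-∈ {y} {i} Σy≡1 i∈S rewrite dec-true (i ∈? S) i∈S = begin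
    sumF (λ j → (½ + ½ * δ i j) * y j)        ≡⟨ sumF-cong distrib ⟩
    sumF (λ j → ½ * y j + ½ * (δ i j * y j))  ≡⟨ sumF-linear-δ ½ ½ i y ⟩
    ½ * sumF y + ½ * y i                      ≡⟨ cong (λ t → ½ * t + ½ * y i) Σy≡1 ⟩
    ½ + ½ * y i                               ∎
    where
    open ≡-Reasoning
    distrib : ∀ j → (½ + ½ * δ i j) * y j ≡ ½ * y j + ½ * (δ i j * y j)
    distrib j = trans (*-distribʳ-+ (y j) ½ (½ * δ i j)) (cong (½ * y j +_) (*-assoc ½ (δ i j) (y j)))

  rowPay-∉ : ∀ {y i} → sumF y ≡ 1ℚ → i ∉ S → rowPay (rowGame S) y i ≡ - 1ℚ
  rowPay-∉ {y} {i} Σy≡1 i∉S rewrite dec-false (i ∈? S) i∉S =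
    trans (sumF-*ˡ (- 1ℚ) y) (cong (- 1ℚ *_) Σy≡1)

  colPay-∈ : ∀ {x j} → sumF x ≡ 1ℚ → j ∈ S → colPay (colGame S) x j ≡ 1ℚ - ½ * x j
  colPay-∈ {x} {j} Σx≡1 j∈S rewrite dec-true (j ∈? S) j∈S = begin
    sumF (λ i → x i * (1ℚ - ½ * δ j i))            ≡⟨ sumF-cong distrib ⟩
    sumF (λ i → 1ℚ * x i + (- ½) * (δ j i * x i))  ≡⟨ sumF-linear-δ 1ℚ (- ½) j x ⟩
    1ℚ * sumF x + (- ½) * x j                      ≡⟨ cong (λ t → 1ℚ * t + (- ½) * x j) Σx≡1 ⟩
    1ℚ + (- ½) * x j                               ≡⟨ cong (1ℚ +_) (neg-distribˡ-* ½ (x j)) ⟨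
    1ℚ - ½ * x j                                   ∎
    where
    open ≡-Reasoning
    distrib : ∀ i → x i * (1ℚ - ½ * δ j i) ≡ 1ℚ * x i + (- ½) * (δ j i * x i)
    distrib i = solve 2 (λ d xᵢ → xᵢ :* (con 1ℚ :- con ½ :* d) := con 1ℚ :* xᵢ :+ (:- con ½) :* (d :* xᵢ))
                        refl (δ j i) (x i)

  colPay-∉ : ∀ {x j} → sumF x ≡ 1ℚ → j ∉ S → colPay (colGame S) x j ≡ - 1ℚ
  colPay-∉ {x} {j} Σx≡1 j∉S rewrite dec-false (j ∈? S) j∉S =
    trans (sumF-cong (λ i → *-comm (x i) (- 1ℚ))) (trans (sumF-*ˡ (- 1ℚ) x) (cong (- 1ℚ *_) Σx≡1))

  rowPay-≥½ : ∀ {y k} → Mixed K y → k ∈ S → ½ ≤ rowPay (rowGame S) y k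
  rowPay-≥½ {y} {k} (y≥0 , Σy≡1) k∈S = begin
    ½                       ≡⟨⟩
    ½ + ½ * 0ℚ              ≤⟨ +-monoʳ-≤ ½ (*-monoˡ-≤-nonNeg ½ (y≥0 k)) ⟩
    ½ + ½ * y k             ≡⟨ rowPay-∈ Σy≡1 k∈S ⟨
    rowPay (rowGame S) y k  ∎
    where open ≤-Reasoning

  colPay-≥½ : ∀ {x k} → Mixed K x → k ∈ S → ½ ≤ colPay (colGame S) x k
  colPay-≥½ {x} {k} (x≥0 , Σx≡1) k∈S = begin
    ½                       ≡⟨⟩
    1ℚ - ½ * 1ℚ             ≤⟨ +-monoʳ-≤ 1ℚ (neg-antimono-≤ (*-monoˡ-≤-nonNeg ½ xₖ≤1)) ⟩
    1ℚ - ½ * x k            ≡⟨ colPay-∈ Σx≡1 k∈S ⟨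
    colPay (colGame S) x k  ∎
    where
    open ≤-Reasoning
    xₖ≤1 : x k ≤ 1ℚ
    xₖ≤1 = subst (x k ≤_) Σx≡1 (≤-sumF x≥0 k)

row-gap : ∀ {a b ε} → ½ + ½ * a - ε ≤ ½ + ½ * b → a ≤ b + (ε + ε)
row-gap {a} {b} {ε} h = begin
  a                                                 ≡⟨ solve 2 (λ a ε →
    a := (con ½ :+ con ½ :* a :- ε) :+ (con ½ :+ con ½ :* a :- ε) :+ (ε :+ ε :- con 1ℚ)) refl a ε ⟩
  (½ + ½ * a - ε) + (½ + ½ * a - ε) + (ε + ε - 1ℚ)  ≤⟨ +-monoˡ-≤ (ε + ε - 1ℚ) (+-mono-≤ h h) ⟩
  (½ + ½ * b) + (½ + ½ * b) + (ε + ε - 1ℚ)          ≡⟨ solve 2 (λ b ε →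
    (con ½ :+ con ½ :* b) :+ (con ½ :+ con ½ :* b) :+ (ε :+ ε :- con 1ℚ) := b :+ (ε :+ ε)) refl b ε ⟩
  b + (ε + ε)                                       ∎
  where open ≤-Reasoning

col-gap : ∀ {a b ε} → 1ℚ - ½ * a - ε ≤ 1ℚ - ½ * b → b ≤ a + (ε + ε)
col-gap {a} {b} {ε} h = begin
  b                                                ≡⟨ solve 1 (λ b →
    b := con 1ℚ :+ con 1ℚ :- ((con 1ℚ :- con ½ :* b) :+ (con 1ℚ :- con ½ :* b))) refl b ⟩
  1ℚ + 1ℚ - ((1ℚ - ½ * b) + (1ℚ - ½ * b))          ≤⟨ +-monoʳ-≤ (1ℚ + 1ℚ) (neg-antimono-≤ (+-mono-≤ h h)) ⟩
  1ℚ + 1ℚ - ((1ℚ - ½ * a - ε) + (1ℚ - ½ * a - ε))  ≡⟨ solve 2 (λ a ε →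
    con 1ℚ :+ con 1ℚ :- ((con 1ℚ :- con ½ :* a :- ε) :+ (con 1ℚ :- con ½ :* a :- ε)) := a :+ (ε :+ ε)) refl a ε ⟩
  a + (ε + ε)                                      ∎
  where open ≤-Reasoning

-- Well-supported equilibria

-- WNE ε R C x y unfolds to WellSupported ε (rowPay R y) x × WellSupported ε (colPay C x) y.
WellSupported : ∀ {K} → ℚ → (Fin K → ℚ) → (Fin K → ℚ) → Set
WellSupported ε payoff z = ∀ i → z i ≢ 0ℚ → ∀ k → payoff k - ε ≤ payoff i

wellSupported⇒supportedIn : ∀ {K} {S : Subset K} {ε payoff z k₀} → ε < 1ℚ → ½ ≤ payoff k₀ →
                            (∀ {i} → i ∉ S → payoff i ≡ - 1ℚ) → WellSupported ε payoff z → SupportedIn S z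
wellSupported⇒supportedIn {S = S} {ε} {payoff} {z} {k₀} ε<1 ½≤payoff₀ payoff-∉ well i zᵢ≢0 =
  decidable-stable (i ∈? S) λ i∉S → <-irrefl refl (begin-strict
    ½             ≤⟨ ½≤payoff₀ ⟩
    payoff k₀     ≤⟨ p-r≤q⇒p≤q+r (well i zᵢ≢0 k₀) ⟩
    payoff i + ε  ≡⟨ cong (_+ ε) (payoff-∉ i∉S) ⟩
    - 1ℚ + ε      <⟨ +-monoʳ-< (- 1ℚ) ε<1 ⟩
    - 1ℚ + 1ℚ     <⟨ positive⁻¹ ½ ⟩
    ½             ∎)
  where open ≤-Reasoning

module WellSupportedEquilibrium {K} {S : Subset K} {ε : ℚ} {x y : Fin K → ℚ} {k₀ : Fin K}
  (0≤ε : 0ℚ ≤ ε) (2Kε<1 : ℕ→ℚ K * (ε + ε) < 1ℚ) (k₀∈S : k₀ ∈ S)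
  (x∈Δ : Mixed K x) (y∈Δ : Mixed K y) (wne : WNE ε (rowGame S) (colGame S) x y) where

  0≤2ε : 0ℚ ≤ ε + ε
  0≤2ε = +-mono-≤ 0≤ε 0≤ε

  ε<1 : ε < 1ℚ
  ε<1 = begin-strict
    ε                ≡⟨ +-identityʳ ε ⟨
    ε + 0ℚ           ≤⟨ +-monoʳ-≤ ε 0≤ε ⟩
    ε + ε            ≡⟨ *-identityˡ (ε + ε) ⟨
    1ℚ * (ε + ε)     ≤⟨ *-monoʳ-≤-nonNeg (ε + ε) {{nonNegative 0≤2ε}} (ℕ→ℚ-mono-≤ (ℕ.m<n⇒0<n (toℕ<n k₀))) ⟩
    ℕ→ℚ K * (ε + ε)  <⟨ 2Kε<1 ⟩
    1ℚ               ∎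
    where open ≤-Reasoning

  1≰2Kε : ¬ (1ℚ ≤ ℕ→ℚ K * (ε + ε))
  1≰2Kε 1≤2Kε = <-irrefl refl (<-≤-trans 2Kε<1 1≤2Kε)

  x-supported : SupportedIn S x
  x-supported = wellSupported⇒supportedIn {payoff = rowPay (rowGame S) y} {k₀ = k₀}
    ε<1 (rowPay-≥½ y∈Δ k₀∈S) (rowPay-∉ (proj₂ y∈Δ)) (proj₁ wne)

  y-supported : SupportedIn S y
  y-supported = wellSupported⇒supportedIn {payoff = colPay (colGame S) x} {k₀ = k₀}
    ε<1 (colPay-≥½ x∈Δ k₀∈S) (colPay-∉ (proj₂ x∈Δ)) (proj₂ wne)

  y-gap : ∀ {i k} → x i ≢ 0ℚ → k ∈ S → y k ≤ y i + (ε + ε)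
  y-gap {i} {k} xᵢ≢0 k∈S = row-gap {y k} {y i} (subst₂ (λ a b → a - ε ≤ b)
    (rowPay-∈ (proj₂ y∈Δ) k∈S) (rowPay-∈ (proj₂ y∈Δ) (x-supported i xᵢ≢0)) (proj₁ wne i xᵢ≢0 k))

  x-gap : ∀ {j k} → y j ≢ 0ℚ → k ∈ S → x j ≤ x k + (ε + ε)
  x-gap {j} {k} yⱼ≢0 k∈S = col-gap {x k} {x j} (subst₂ (λ a b → a - ε ≤ b)
    (colPay-∈ (proj₂ x∈Δ) k∈S) (colPay-∈ (proj₂ x∈Δ) (y-supported j yⱼ≢0)) (proj₂ wne j yⱼ≢0 k))

  x-nearlyUniform : NearlyUniformOn S (ε + ε) x
  x-nearlyUniform {i} {k} i∈S k∈S with y i ≟ 0ℚ | x i ≟ 0ℚ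
  ... | no  yᵢ≢0 | _        = x-gap yᵢ≢0 k∈S
  ... | yes _    | yes xᵢ≡0 = subst (_≤ x k + (ε + ε)) (sym xᵢ≡0) (+-mono-≤ (proj₁ x∈Δ k) 0≤2ε)
  ... | yes yᵢ≡0 | no  xᵢ≢0 = ⊥-elim (1≰2Kε (vanishing-near-all⇒1≤K*η y∈Δ y-supported 0≤2ε yᵢ≡0 (y-gap xᵢ≢0)))

  y-nearlyUniform : NearlyUniformOn S (ε + ε) y
  y-nearlyUniform {i} {k} i∈S k∈S with x k ≟ 0ℚ
  ... | no  xₖ≢0 = y-gap xₖ≢0 i∈S
  ... | yes xₖ≡0 = ⊥-elim (1≰2Kε (vanishing-near-all⇒1≤K*η x∈Δ x-supported 0≤2ε xₖ≡0
                                    (λ j∈S → x-nearlyUniform j∈S k∈S)))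

enumerationHard : ∀ {K} (S : Subset K) {ε} → Nonempty S → 0ℚ ≤ ε → ℕ→ℚ K * (ε + ε) < 1ℚ →
                  EnumHard K ε (ℕ→ℚ K + ℕ→ℚ K) 1ℚ K ≤-refl S (rowGame S) (colGame S)
enumerationHard {K} S {ε} (k₀ , k₀∈S) 0≤ε 2Kε<1 =
  *-identityˡ (ℕ→ℚ K) , rowGame-bounded S , colGame-bounded S ,
  (λ y y∈Δ → k₀ , rowPay-≥½ y∈Δ k₀∈S) , (λ x x∈Δ → k₀ , colPay-≥½ x∈Δ k₀∈S) ,
  λ x y x∈Δ y∈Δ wne → let open WellSupportedEquilibrium 0≤ε 2Kε<1 k₀∈S x∈Δ y∈Δ wne in
    (λ i → x-supported (inject≤ i ≤-refl)) , (λ i → y-supported (inject≤ i ≤-refl)) ,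
    close-to-uniform x∈Δ x-supported x-nearlyUniform , close-to-uniform y∈Δ y-supported y-nearlyUniform
  where
  close-to-uniform : ∀ {z} → Mixed K z → SupportedIn S z → NearlyUniformOn S (ε + ε) z →
                     norm1 (λ i → prefix K ≤-refl z i - 1ℚ * uvec K ≤-refl S i) ≤ (ℕ→ℚ K + ℕ→ℚ K) * ε
  close-to-uniform z∈Δ supp uniform =
    subst (_ ≤_) (solve 2 (λ k ε → k :* (ε :+ ε) := (k :+ k) :* ε) refl (ℕ→ℚ K) ε)
      (nearlyUniform⇒norm1 (+-mono-≤ 0≤ε 0≤ε) z∈Δ supp uniform)

-- A separated family of subsets

subsets : ∀ n → List (Subset n)
subsets zero    = [] ∷ []
subsets (suc n) = map (inside ∷_) (subsets n) ++ map (outside ∷_) (subsets n)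

length-subsets : ∀ n → length (subsets n) ≡ 2 ^ n
length-subsets zero    = refl
length-subsets (suc n) = begin
  length (map (inside ∷_) (subsets n) ++ map (outside ∷_) (subsets n))
    ≡⟨ length-++ (map (inside ∷_) (subsets n)) ⟩
  length (map (inside ∷_) (subsets n)) ℕ.+ length (map (outside ∷_) (subsets n))
    ≡⟨ cong₂ ℕ._+_ (length-map (inside ∷_) (subsets n)) (length-map (outside ∷_) (subsets n)) ⟩
  length (subsets n) ℕ.+ length (subsets n)
    ≡⟨ cong (λ m → m ℕ.+ m) (length-subsets n) ⟩
  2 ^ n ℕ.+ 2 ^ n
    ≡⟨ cong (2 ^ n ℕ.+_) (ℕ.+-identityʳ (2 ^ n)) ⟨
  2 ^ suc n
    ∎
  where open ≡-Reasoning

subsets-unique : ∀ n → Unique (subsets n)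
subsets-unique zero    = [] ∷ []
subsets-unique (suc n) =
  ++⁺ (map⁺ ∷-injectiveʳ (subsets-unique n)) (map⁺ ∷-injectiveʳ (subsets-unique n)) disjoint
  where
  disjoint : ∀ {T} → ¬ (T ∈L map (inside ∷_) (subsets n) × T ∈L map (outside ∷_) (subsets n))
  disjoint (T∈ins , T∈outs) with ∈-map⁻ (inside ∷_) T∈ins | ∈-map⁻ (outside ∷_) T∈outs
  ... | _ , _ , refl | _ , _ , ()

Separates : ∀ {K} → Fin K → Subset K → Subset K → Set
Separates k S S′ = (k ∈ S × k ∉ S′) ⊎ (k ∈ S′ × k ∉ S)

separates-suc : ∀ {K} {S S′ : Subset K} {b b′ k} → Separates k S S′ → Separates (suc k) (b ∷ S) (b′ ∷ S′)
separates-suc (inj₁ (k∈S , k∉S′)) = inj₁ (there k∈S , k∉S′ ∘ drop-there)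
separates-suc (inj₂ (k∈S′ , k∉S)) = inj₂ (there k∈S′ , k∉S ∘ drop-there)

≢⇒separated : ∀ {K} {S S′ : Subset K} → S ≢ S′ → ∃ λ k → Separates k S S′
≢⇒separated {S = []}          {[]}          S≢S′ = contradiction refl S≢S′
≢⇒separated {S = inside ∷ _}  {outside ∷ _} _    = zero , inj₁ (here , λ ())
≢⇒separated {S = outside ∷ _} {inside ∷ _}  _    = zero , inj₂ (here , λ ())
≢⇒separated {S = inside ∷ _}  {inside ∷ _}  S≢S′ =
  let k , sep = ≢⇒separated (S≢S′ ∘ cong (inside ∷_)) in suc k , separates-suc sep
≢⇒separated {S = outside ∷ _} {outside ∷ _} S≢S′ =
  let k , sep = ≢⇒separated (S≢S′ ∘ cong (outside ∷_)) in suc k , separates-suc sep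

module _ {K m} {m≤K : m ℕ.≤ K} {S : Subset K} {i : Fin m} where

  uvec-∈ : inject≤ i m≤K ∈ S → uvec m m≤K S i ≡ inv (card S)
  uvec-∈ j∈S with inject≤ i m≤K ∈? S
  ... | yes _   = refl
  ... | no  j∉S = contradiction j∈S j∉S

  uvec-∉ : inject≤ i m≤K ∉ S → uvec m m≤K S i ≡ 0ℚ
  uvec-∉ j∉S with inject≤ i m≤K ∈? S
  ... | yes j∈S = contradiction j∈S j∉S
  ... | no  _   = refl

∣uvec-uvec∣ : ∀ {K} {S S′ : Subset K} {k} → k ∈ S → k ∉ S′ →
              ∣ uvec K ≤-refl S k - uvec K ≤-refl S′ k ∣ ≡ inv (card S)
∣uvec-uvec∣ {K} {S} {S′} {k} k∈S k∉S′ = begin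
  ∣ uvec K ≤-refl S k - uvec K ≤-refl S′ k ∣
    ≡⟨ cong₂ (λ p q → ∣ p - q ∣) (uvec-∈ {m≤K = ≤-refl} {i = k} (subst (_∈ S) k≡j k∈S))
                                 (uvec-∉ {m≤K = ≤-refl} {i = k} (k∉S′ ∘ subst (_∈ S′) (sym k≡j))) ⟩
  ∣ inv (card S) - 0ℚ ∣
    ≡⟨ cong ∣_∣ (+-identityʳ (inv (card S))) ⟩
  ∣ inv (card S) ∣
    ≡⟨ 0≤p⇒∣p∣≡p (inv-nonNeg (card S)) ⟩
  inv (card S)
    ∎
  where
  open ≡-Reasoning
  k≡j : k ≡ inject≤ k ≤-refl
  k≡j = sym (inject≤-refl k ≤-refl)

uvec-separated : ∀ {K} {S S′ : Subset K} {a} → S ≢ S′ → a < inv (card S) → a < inv (card S′) →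
                 a < norm1 (λ i → uvec K ≤-refl S i - uvec K ≤-refl S′ i)
uvec-separated {K} {S} {S′} {a} S≢S′ a<1/s a<1/s′ with ≢⇒separated S≢S′
... | k , inj₁ (k∈S , k∉S′) = begin-strict
  a                                                     <⟨ a<1/s ⟩
  inv (card S)                                          ≡⟨ ∣uvec-uvec∣ k∈S k∉S′ ⟨
  ∣ uvec K ≤-refl S k - uvec K ≤-refl S′ k ∣            ≤⟨ ≤-sumF (λ i → 0≤∣p∣ _) k ⟩
  norm1 (λ i → uvec K ≤-refl S i - uvec K ≤-refl S′ i)  ∎
  where open ≤-Reasoning
... | k , inj₂ (k∈S′ , k∉S) = begin-strict
  a                                                     <⟨ a<1/s′ ⟩
  inv (card S′)                                         ≡⟨ ∣uvec-uvec∣ k∈S′ k∉S ⟨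
  ∣ uvec K ≤-refl S′ k - uvec K ≤-refl S k ∣            ≡⟨ ∣p-q∣≡∣q-p∣ (uvec K ≤-refl S′ k) (uvec K ≤-refl S k) ⟩
  ∣ uvec K ≤-refl S k - uvec K ≤-refl S′ k ∣            ≤⟨ ≤-sumF (λ i → 0≤∣p∣ _) k ⟩
  norm1 (λ i → uvec K ≤-refl S i - uvec K ≤-refl S′ i)  ∎
  where open ≤-Reasoning

module Construction (n : ℕ) where

  K : ℕ
  K = suc n

  -- 18 (τ + 1) ε = a / M, which a K < M puts below 1/K.
  a : ℕ
  a = 18 ℕ.* (K ℕ.+ K ℕ.+ 1)

  M : ℕ
  M = suc (a ℕ.* K)

  ε : ℚ
  ε = inv M

  τ : ℚ
  τ = ℕ→ℚ K + ℕ→ℚ K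

  family : List (Subset K)
  family = map (inside ∷_) (subsets n)

  K+K≤a : K ℕ.+ K ℕ.≤ a
  K+K≤a = ℕ.≤-trans (ℕ.m≤m+n (K ℕ.+ K) 1) (ℕ.m≤n*m (K ℕ.+ K ℕ.+ 1) 18)

  ε-pos : 0ℚ < ε
  ε-pos = positive⁻¹ ε {{inv-pos M}}

  2Kε<1 : ℕ→ℚ K * (ε + ε) < 1ℚ
  2Kε<1 = begin-strict
    ℕ→ℚ K * (ε + ε)      ≡⟨ solve 2 (λ k e → k :* (e :+ e) := (k :+ k) :* e) refl (ℕ→ℚ K) ε ⟩
    (ℕ→ℚ K + ℕ→ℚ K) * ε  ≡⟨ cong (_* ε) (ℕ→ℚ-homo-+ K K) ⟨
    ℕ→ℚ (K ℕ.+ K) * ε    <⟨ *inv<inv (K ℕ.+ K) 1 M (s≤s (ℕ.*-mono-≤ K+K≤a (s≤s z≤n))) ⟩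
    inv 1                ∎
    where open ≤-Reasoning

  εn²≤1 : ε * ℕ→ℚ (n ^ 2) ≤ ℕ→ℚ 1
  εn²≤1 = begin
    ε * ℕ→ℚ (n ^ 2)  ≡⟨ *-comm ε (ℕ→ℚ (n ^ 2)) ⟩
    ℕ→ℚ (n ^ 2) * ε  <⟨ *inv<inv (n ^ 2) 1 M (s≤s (subst (ℕ._≤ a ℕ.* K) n*n≡n²*1 (ℕ.*-mono-≤ n≤a (ℕ.n≤1+n n)))) ⟩
    inv 1            ∎
    where
    open ≤-Reasoning
    n≤a : n ℕ.≤ a
    n≤a = ℕ.≤-trans (ℕ.n≤1+n n) (ℕ.≤-trans (ℕ.m≤m+n K K) K+K≤a)
    n*n≡n²*1 : n ℕ.* n ≡ n ^ 2 ℕ.* 1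
    n*n≡n²*1 = sym (trans (ℕ.*-identityʳ (n ^ 2)) (cong (n ℕ.*_) (ℕ.*-identityʳ n)))

  K≤2n : 1 ℕ.≤ n → K ℕ.≤ 2 ℕ.* n
  K≤2n 1≤n = subst (K ℕ.≤_) (n+n≡2n n) (ℕ.+-monoˡ-≤ n 1≤n)
    where
    n+n≡2n : ∀ n → n ℕ.+ n ≡ 2 ℕ.* n
    n+n≡2n = solve-∀

  τ-pos : 0ℚ < τ
  τ-pos = subst (0ℚ <_) (ℕ→ℚ-homo-+ K K) (ℕ→ℚ-mono-< {0} {K ℕ.+ K} (s≤s z≤n))

  τ≤4n : 1 ℕ.≤ n → τ ≤ ℕ→ℚ 4 * ℕ→ℚ n
  τ≤4n 1≤n = begin
    ℕ→ℚ K + ℕ→ℚ K  ≡⟨ ℕ→ℚ-homo-+ K K ⟨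
    ℕ→ℚ (K ℕ.+ K)  ≤⟨ ℕ→ℚ-mono-≤ (subst (K ℕ.+ K ℕ.≤_) (2n+2n≡4n n) (ℕ.+-mono-≤ (K≤2n 1≤n) (K≤2n 1≤n))) ⟩
    ℕ→ℚ (4 ℕ.* n)  ≡⟨ ℕ→ℚ-homo-* 4 n ⟩
    ℕ→ℚ 4 * ℕ→ℚ n  ∎
    where
    open ≤-Reasoning
    2n+2n≡4n : ∀ n → 2 ℕ.* n ℕ.+ 2 ℕ.* n ≡ 4 ℕ.* n
    2n+2n≡4n = solve-∀

  family-unique : Unique family
  family-unique = map⁺ ∷-injectiveʳ (subsets-unique n)

  family-length : 2 ^ n ℕ.≤ length family ^ 1
  family-length = ℕ.≤-reflexive (sym (begin
    length family ^ 1   ≡⟨ ℕ.^-identityʳ (length family) ⟩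
    length family       ≡⟨ length-map (inside ∷_) (subsets n) ⟩
    length (subsets n)  ≡⟨ length-subsets n ⟩
    2 ^ n               ∎))
    where open ≡-Reasoning

  zero∈family : ∀ {S} → S ∈L family → zero ∈ S
  zero∈family S∈family with ∈-map⁻ (inside ∷_) S∈family
  ... | _ , _ , refl = here

  family-hard : ∀ S → S ∈L family → ∃ λ R → ∃ λ C → EnumHard K ε τ 1ℚ K ≤-refl S R C
  family-hard S S∈family =
    rowGame S , colGame S , enumerationHard S (zero , zero∈family S∈family) (<⇒≤ ε-pos) 2Kε<1

  family-separated : ∀ S S′ → S ∈L family → S′ ∈L family → S ≢ S′ →
                     ℕ→ℚ 18 * (τ + 1ℚ) * ε < norm1 (λ i → uvec K ≤-refl S i - uvec K ≤-refl S′ i)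
  family-separated S S′ S∈family S′∈family S≢S′ =
    subst (_< norm1 (λ i → uvec K ≤-refl S i - uvec K ≤-refl S′ i)) aε≡margin
      (uvec-separated S≢S′ (aε<inv S∈family) (aε<inv S′∈family))
    where
    aε<inv : ∀ {T} → T ∈L family → ℕ→ℚ a * ε < inv (card T)
    aε<inv {T} T∈family =
      *inv<inv a (card T) M {{card-nonZero (zero∈family T∈family)}} (s≤s (ℕ.*-monoʳ-≤ a (∣p∣≤n T)))
    aε≡margin : ℕ→ℚ a * ε ≡ ℕ→ℚ 18 * (τ + 1ℚ) * ε
    aε≡margin = cong (_* ε) (begin
      ℕ→ℚ (18 ℕ.* (K ℕ.+ K ℕ.+ 1))   ≡⟨ ℕ→ℚ-homo-* 18 (K ℕ.+ K ℕ.+ 1) ⟩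
      ℕ→ℚ 18 * ℕ→ℚ (K ℕ.+ K ℕ.+ 1)   ≡⟨ cong (ℕ→ℚ 18 *_) (ℕ→ℚ-homo-+ (K ℕ.+ K) 1) ⟩
      ℕ→ℚ 18 * (ℕ→ℚ (K ℕ.+ K) + 1ℚ)  ≡⟨ cong (λ t → ℕ→ℚ 18 * (t + 1ℚ)) (ℕ→ℚ-homo-+ K K) ⟩
      ℕ→ℚ 18 * (τ + 1ℚ)              ∎)
      where open ≡-Reasoning

mainTheorem13 :
  ∃ λ (c₁ : ℕ) → ∃ λ (c₂ : ℕ) → ∃ λ (c₃ : ℕ) → ∃ λ (d : ℕ) →
  1 ℕ.≤ c₁ × 1 ℕ.≤ c₂ × 1 ℕ.≤ c₃ × 1 ℕ.≤ d ×
  ∃ λ (N : ℕ) → ∀ (n : ℕ) → N ℕ.≤ n →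
    ∃ λ (K : ℕ) → 1 ℕ.≤ K × K ℕ.≤ c₁ ℕ.* n ×
    ∃ λ (ε : ℚ) → 0ℚ < ε × ε * ℕ→ℚ (n ^ 2) ≤ ℕ→ℚ c₂ ×
    ∃ λ (τ : ℚ) → 0ℚ < τ × τ ≤ ℕ→ℚ c₃ * ℕ→ℚ n ×
    ∃ λ (F : List (Subset K)) → Unique F × 2 ^ n ℕ.≤ length F ^ d ×
      (∀ S → S ∈L F → ∃ λ R → ∃ λ C → EnumHard K ε τ 1ℚ K ≤-refl S R C) ×
      (∀ S S′ → S ∈L F → S′ ∈L F → S ≢ S′ →
         ℕ→ℚ 18 * (τ + 1ℚ) * ε < norm1 (λ i → uvec K ≤-refl S i - uvec K ≤-refl S′ i))
mainTheorem13 = 2 , 1 , 4 , 1 , s≤s z≤n , s≤s z≤n , s≤s z≤n , s≤s z≤n , 1 , λ n 1≤n →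
  let open Construction n in
  K , s≤s z≤n , K≤2n 1≤n , ε , ε-pos , εn²≤1 , τ , τ-pos , τ≤4n 1≤n ,
  family , family-unique , family-length , family-hard , family-separated
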